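{- Let $H=(V,E)$ be an intersection-closed hypergraph, let $e\in E$, and let $e_0\subsetneq e_1\subsetneq\cdots\subsetneq e_l$ be a maximal $e$-chain in $H$. For each $i\in[0;l-1]$ let $v_i$ be an arbitrary element of $e_{i+1}\setminus e_i$. Then $M_H(\{v_0,\ldots,v_{l-1}\})=e$.
   Context: A hypergraph is a pair $H=(V,E)$ with $V$ finite and $E\subseteq 2^V$. $H$ is intersection-closed if $V\in E$ and $e\cap f\in E$ for all $e,f\in E$. For $e\in E$, an $e$-chain is a sequence $e_0\subsetneq e_1\subsetneq\cdots\subsetneq e_l$ of edges of $H$ with $e_l=e$; it is maximal if it cannot be extended by inserting a further edge of $H$ (anywhere in the sequence, including before $e_0$) while remaining an $e$-chain. For $S\subseteq V$, $K_H(S)=\{f\in E:S\subseteq f\}$, and $M_H(S)=V$ if $K_H(S)=\emptyset$, $M_H(S)=\bigcap_{f\in K_H(S)}f$ otherwise. -}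

module Defs where

open import Data.Nat using (ℕ; suc)
open import Data.Fin using (Fin; zero; suc; inject₁; fromℕ)
open import Data.Fin.Subset using (Subset; _⊆_; _⊂_; _∩_; ⊤; ⋂; ⋃; ⁅_⁆)
open import Data.Fin.Subset.Properties using (_⊆?_)
open import Data.List using (List; filter; map; allFin)
open import Data.List.Membership.Propositional using () renaming (_∈_ to _∈ₗ_)
open import Data.Product using (_×_)
open import Relation.Nullary using (¬_)
open import Relation.Binary.PropositionalEquality using (_≡_)

-- A hypergraph on vertex set V = Fin n is given by its edge list E (a list of
-- subsets of Fin n; duplicates are harmless).

IntersectionClosed : {n : ℕ} → List (Subset n) → Set
IntersectionClosed {n} E =
  (⊤ ∈ₗ E) × (∀ {e f : Subset n} → e ∈ₗ E → f ∈ₗ E → (e ∩ f) ∈ₗ E)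

K : {n : ℕ} → List (Subset n) → Subset n → List (Subset n)
K E S = filter (S ⊆?_) E

-- M_H(S) = ⋂ K_H(S), and = V when K_H(S) is empty (⋂ [] = ⊤ = V).
M : {n : ℕ} → List (Subset n) → Subset n → Subset n
M E S = ⋂ (K E S)

IsChain : {n : ℕ} → List (Subset n) → Subset n → (l : ℕ) →
          (Fin (suc l) → Subset n) → Set
IsChain E e l c =
  (∀ (i : Fin (suc l)) → c i ∈ₗ E)
  × (∀ (i : Fin l) → c (inject₁ i) ⊂ c (suc i))
  × (c (fromℕ l) ≡ e)

-- Maximal e-chain: no edge of H can be inserted (before e_0, or strictly
-- between e_i and e_{i+1}) so that the result is still an e-chain.
IsMaximalChain : {n : ℕ} → List (Subset n) → Subset n → (l : ℕ) →
                 (Fin (suc l) → Subset n) → Set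
IsMaximalChain {n} E e l c =
  IsChain E e l c
  × (∀ (f : Subset n) → f ∈ₗ E → ¬ (f ⊂ c zero))
  × (∀ (i : Fin l) (f : Subset n) → f ∈ₗ E →
       ¬ ((c (inject₁ i) ⊂ f) × (f ⊂ c (suc i))))

setOf : {n l : ℕ} → (Fin l → Fin n) → Subset n
setOf {n} {l} v = ⋃ (map (λ i → ⁅ v i ⁆) (allFin l))

-- M(S) for S = {v₀, …, v_{l-1}} is an edge containing S, being an
-- intersection of edges, and it lies inside e since e contains S. Conversely,
-- every member of the chain lies in M(S): intersecting M(S) with e₀ gives an
-- edge below e₀, which minimality forces to be e₀; if eᵢ ⊆ M(S), then
-- M(S) ∩ e_{i+1} is an edge strictly between eᵢ (it contains vᵢ) and e_{i+1},
-- which maximality forces to be e_{i+1}. Hence e = e_l ⊆ M(S).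
module Submission where

open import Defs
open import Data.Nat using (ℕ; suc)
open import Data.Fin using (Fin; zero; suc; inject₁; fromℕ)
open import Data.Fin.Induction using (<-weakInduction; >-weakInduction)
open import Data.Fin.Subset using (Subset; _∈_; _∉_; _⊆_; _⊂_; _⊄_; _∩_; ⋂; ⋃; ⁅_⁆)
open import Data.Fin.Subset.Properties
  using (_∈?_; _⊆?_; ⊆-reflexive; ⊆-trans; ⊆-antisym; ∈⊤; ∉⊥; p∩q⊆p; p∩q⊆q; x∈p∩q⁺;
         x∈p∪q⁺; x∈p∪q⁻; x∈⁅x⁆; x∈⁅y⁆⇒x≡y)
open import Data.List using (List; []; _∷_; map; allFin)
open import Data.List.Relation.Unary.Any using (here; there)
open import Data.List.Membership.Propositional using () renaming (_∈_ to _∈ₗ_)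
open import Data.List.Membership.Propositional.Properties
  using (∈-filter⁺; ∈-filter⁻; ∈-map⁺; ∈-map⁻; ∈-allFin)
open import Data.Product using (_×_; _,_; proj₁; proj₂)
open import Data.Sum using (inj₁; inj₂)
open import Data.Empty using (⊥-elim)
open import Function using (_∘_)
open import Relation.Nullary using (yes; no)
open import Relation.Binary.PropositionalEquality using (_≡_; refl; sym; subst)

private
  variable
    n l : ℕ

∩⊄⇒⊆ : (p q : Subset n) → p ∩ q ⊄ q → q ⊆ p
∩⊄⇒⊆ p q p∩q⊄q {x} x∈q with x ∈? p
... | yes x∈p = x∈p
... | no  x∉p = ⊥-elim (p∩q⊄q (p∩q⊆q p q , x , x∈q , x∉p ∘ p∩q⊆p p q))

⋂-lowerBound : (ys : List (Subset n)) {y : Subset n} → y ∈ₗ ys → ⋂ ys ⊆ y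
⋂-lowerBound (y ∷ ys) (here refl) = p∩q⊆p y (⋂ ys)
⋂-lowerBound (y ∷ ys) (there y∈ys) = ⊆-trans (p∩q⊆q y (⋂ ys)) (⋂-lowerBound ys y∈ys)

⋂-greatest : (ys : List (Subset n)) {s : Subset n} →
             (∀ {y} → y ∈ₗ ys → s ⊆ y) → s ⊆ ⋂ ys
⋂-greatest []       s⊆ys x∈s = ∈⊤
⋂-greatest (y ∷ ys) s⊆ys x∈s =
  x∈p∩q⁺ (s⊆ys (here refl) x∈s , ⋂-greatest ys (s⊆ys ∘ there) x∈s)

⋃-upperBound : (ys : List (Subset n)) {y : Subset n} → y ∈ₗ ys → y ⊆ ⋃ ys
⋃-upperBound (y ∷ ys) (here refl) x∈y = x∈p∪q⁺ (inj₁ x∈y)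
⋃-upperBound (y ∷ ys) (there y∈ys) x∈y = x∈p∪q⁺ (inj₂ (⋃-upperBound ys y∈ys x∈y))

⋃-least : (ys : List (Subset n)) {t : Subset n} →
          (∀ {y} → y ∈ₗ ys → y ⊆ t) → ⋃ ys ⊆ t
⋃-least []       ys⊆t x∈⊥ = ⊥-elim (∉⊥ x∈⊥)
⋃-least (y ∷ ys) ys⊆t {x} x∈⋃ with x∈p∪q⁻ y (⋃ ys) x∈⋃
... | inj₁ x∈y  = ys⊆t (here refl) x∈y
... | inj₂ x∈ys = ⋃-least ys (ys⊆t ∘ there) x∈ys

⋂-closed : {E : List (Subset n)} → IntersectionClosed E →
           (ys : List (Subset n)) → (∀ {y} → y ∈ₗ ys → y ∈ₗ E) → ⋂ ys ∈ₗ E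
⋂-closed (⊤∈E , _) []       _ = ⊤∈E
⋂-closed closed@(_ , ∩-closed) (y ∷ ys) ys⊆E =
  ∩-closed (ys⊆E (here refl)) (⋂-closed closed ys (ys⊆E ∘ there))

module _ {E : List (Subset n)} {s : Subset n} where

  M-edge : IntersectionClosed E → M E s ∈ₗ E
  M-edge closed = ⋂-closed closed (K E s) (proj₁ ∘ ∈-filter⁻ (s ⊆?_) {xs = E})

  ⊆-M : s ⊆ M E s
  ⊆-M = ⋂-greatest (K E s) (proj₂ ∘ ∈-filter⁻ (s ⊆?_) {xs = E})

  M-least : {f : Subset n} → f ∈ₗ E → s ⊆ f → M E s ⊆ f
  M-least f∈E s⊆f = ⋂-lowerBound (K E s) (∈-filter⁺ (s ⊆?_) f∈E s⊆f)

module _ {v : Fin l → Fin n} where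

  ∈-setOf : (i : Fin l) → v i ∈ setOf v
  ∈-setOf i = ⋃-upperBound _ (∈-map⁺ (λ j → ⁅ v j ⁆) (∈-allFin i)) (x∈⁅x⁆ (v i))

  setOf-least : {t : Subset n} → (∀ i → v i ∈ t) → setOf v ⊆ t
  setOf-least {t} v⊆t = ⋃-least _ singleton⊆t
    where
    singleton⊆t : ∀ {y} → y ∈ₗ map (λ j → ⁅ v j ⁆) (allFin l) → y ⊆ t
    singleton⊆t y∈ x∈y with ∈-map⁻ (λ j → ⁅ v j ⁆) y∈
    ... | i , _ , refl = subst (_∈ t) (sym (x∈⁅y⁆⇒x≡y (v i) x∈y)) (v⊆t i)

module _ {E : List (Subset n)} {e : Subset n} {c : Fin (suc l) → Subset n} where

  chain⊆top : IsChain E e l c → ∀ j → c j ⊆ e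
  chain⊆top (_ , c⊂c , c-top≡e) =
    >-weakInduction (λ j → c j ⊆ e) (⊆-reflexive c-top≡e)
                    (λ i cᵢ₊₁⊆e → ⊆-trans (proj₁ (c⊂c i)) cᵢ₊₁⊆e)

  maximalChain⊆edge : IntersectionClosed E → IsMaximalChain E e l c →
                      (v : Fin l → Fin n) →
                      (∀ i → v i ∈ c (suc i) × v i ∉ c (inject₁ i)) →
                      {m : Subset n} → m ∈ₗ E → (∀ i → v i ∈ m) → ∀ j → c j ⊆ m
  maximalChain⊆edge (_ , ∩-closed) ((c∈E , c⊂c , _) , nothing-below , nothing-between)
                    v v-new {m} m∈E v∈m =
    <-weakInduction (λ j → c j ⊆ m) c₀⊆m cᵢ⊆m⇒cᵢ₊₁⊆m
    where
    c₀⊆m : c zero ⊆ m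
    c₀⊆m = ∩⊄⇒⊆ m (c zero) (nothing-below _ (∩-closed m∈E (c∈E zero)))

    cᵢ⊆m⇒cᵢ₊₁⊆m : ∀ i → c (inject₁ i) ⊆ m → c (suc i) ⊆ m
    cᵢ⊆m⇒cᵢ₊₁⊆m i cᵢ⊆m = ∩⊄⇒⊆ m (c (suc i)) (λ m∩cᵢ₊₁⊂cᵢ₊₁ →
      nothing-between i _ (∩-closed m∈E (c∈E (suc i))) (cᵢ⊂m∩cᵢ₊₁ , m∩cᵢ₊₁⊂cᵢ₊₁))
      where
      cᵢ⊂m∩cᵢ₊₁ : c (inject₁ i) ⊂ m ∩ c (suc i)
      cᵢ⊂m∩cᵢ₊₁ = (λ x∈cᵢ → x∈p∩q⁺ (cᵢ⊆m x∈cᵢ , proj₁ (c⊂c i) x∈cᵢ))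
                , v i , x∈p∩q⁺ (v∈m i , proj₁ (v-new i)) , proj₂ (v-new i)

lemma3 : {n : ℕ} (E : List (Subset n)) → IntersectionClosed E →
         (e : Subset n) → e ∈ₗ E →
         (l : ℕ) (c : Fin (suc l) → Subset n) → IsMaximalChain E e l c →
         (v : Fin l → Fin n) →
         (∀ (i : Fin l) → (v i ∈ c (suc i)) × (v i ∉ c (inject₁ i))) →
         M E (setOf v) ≡ e
lemma3 E closed e e∈E l c maximal@(chain@(_ , _ , c-top≡e) , _) v v-new =
  ⊆-antisym M⊆e e⊆M
  where
  M⊆e : M E (setOf v) ⊆ e
  M⊆e = M-least e∈E (setOf-least (λ i → chain⊆top chain (suc i) (proj₁ (v-new i))))

  e⊆M : e ⊆ M E (setOf v)
  e⊆M = subst (_⊆ M E (setOf v)) c-top≡e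
          (maximalChain⊆edge closed maximal v v-new (M-edge {s = setOf v} closed)
                             (⊆-M {E = E} ∘ ∈-setOf) (fromℕ l))
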